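{- Suppose $H$ is a $(\mu,\nu)$-robustly $2$-matchable graph on $n$ vertices and let $\varepsilon>0$. Suppose $H'$ is a spanning subgraph of $H$ such that $\deg_{H'}(v)\ge\deg_H(v)-\varepsilon n$ for every vertex $v$. Then $H'$ is $(\mu+\varepsilon,\nu-\varepsilon)$-robustly $2$-matchable, and its type coincides with that of $H$.
   Context: A graph $H$ on $n$ vertices is $(\mu,\nu)$-robustly $2$-matchable if one of the following holds. (Type 1) $\delta(H)\ge(1/2-\mu)n$ and every set of $(1/2-\nu)n$ vertices spans at least $\nu n^2$ edges. (Type 2) $H$ is a balanced bipartite graph with parts $A,B$ of size $n/2$ such that $\delta(H)\ge(1/32-\mu)n$ and all but at most $(1/64+\mu)n$ vertices of $H$ have degree at least $(1/3-\mu)n$. The type of $H$ refers to which of these two conditions is satisfied.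
   Formalization: The parameters μ, ν and ε range over the rationals. -}

module Defs where

open import Data.Bool using (Bool; true; false; if_then_else_; _∧_)
open import Data.Nat as ℕ using (ℕ; zero; suc)
open import Data.Fin using (Fin; toℕ) renaming (zero to fzero; suc to fsuc)
open import Data.Fin.Subset using (Subset; inside; outside; _∈_; _∉_; ∣_∣)
open import Data.Vec using (lookup)
open import Data.Integer using (+_)
open import Data.Rational using (ℚ; _/_; _+_; _-_; _*_; _≤_; _<_; ½; 0ℚ)
open import Data.Product using (_×_; ∃; Σ)
open import Data.Sum using (_⊎_)
open import Relation.Binary.PropositionalEquality using (_≡_; _≢_)
open import Relation.Nullary using (does)

ι : ℕ → ℚ
ι m = + m / 1

count : ∀ {n} → (Fin n → Bool) → ℕ
count {zero}  f = 0
count {suc n} f = (if f fzero then 1 else 0) ℕ.+ count (λ i → f (fsuc i))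

sumFin : ∀ {n} → (Fin n → ℕ) → ℕ
sumFin {zero}  f = 0
sumFin {suc n} f = f fzero ℕ.+ sumFin (λ i → f (fsuc i))

record Graph (n : ℕ) : Set where
  field
    adj    : Fin n → Fin n → Bool
    sym    : ∀ i j → adj i j ≡ adj j i
    irrefl : ∀ i → adj i i ≡ false
open Graph public

deg : ∀ {n} → Graph n → Fin n → ℕ
deg G v = count (adj G v)

inS : ∀ {n} → Subset n → Fin n → Bool
inS S i with lookup S i
... | inside  = true
... | outside = false

eSpan : ∀ {n} → Graph n → Subset n → ℕ
eSpan G S = sumFin (λ i → count (λ j →
  inS S i ∧ inS S j ∧ adj G i j ∧ does (toℕ i ℕ.<? toℕ j)))

MinDeg≥ : ∀ {n} → Graph n → ℚ → Set
MinDeg≥ {n} G c = ∀ v → c * ι n ≤ ι (deg G v)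

Type1 : ℚ → ℚ → ∀ {n} → Graph n → Set
Type1 μ ν {n} H =
  MinDeg≥ H (½ - μ) ×
  (∀ (S : Subset n) → (½ - ν) * ι n ≤ ι ∣ S ∣ → ν * ι n * ι n ≤ ι (eSpan H S))

BalancedBipartite : ∀ {n} → Graph n → Subset n → Set
BalancedBipartite {n} H A =
  (∣ A ∣ ℕ.* 2 ≡ n) × (∀ i j → adj H i j ≡ true → lookup A i ≢ lookup A j)

Type2 : ℚ → ℚ → ∀ {n} → Graph n → Set
Type2 μ ν {n} H =
  (∃ λ (A : Subset n) → BalancedBipartite H A) ×
  MinDeg≥ H ((+ 1 / 32) - μ) ×
  (∃ λ (X : Subset n) → ι ∣ X ∣ ≤ ((+ 1 / 64) + μ) * ι n ×
     (∀ v → v ∉ X → ((+ 1 / 3) - μ) * ι n ≤ ι (deg H v)))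

RobustlyTwoMatchable : ℚ → ℚ → ∀ {n} → Graph n → Set
RobustlyTwoMatchable μ ν H = Type1 μ ν H ⊎ Type2 μ ν H

SpanningSubgraph : ∀ {n} → Graph n → Graph n → Set
SpanningSubgraph H' H = ∀ i j → adj H' i j ≡ true → adj H i j ≡ true

module Submission where

-- Write N = ι n.  Since H' ⊆ H, the degree of v in H splits as
-- deg_H v = deg_H' v + (number of H-edges at v lost in H'), so the degree
-- hypothesis says exactly that at most εN edges are lost at each vertex.
-- Every condition in the definition is then shifted by ε:
--   * minimum-degree and "most vertices have large degree" bounds drop by at
--     most εN, which is absorbed by replacing μ with μ + ε;
--   * the exceptional set X may stay the same, its allowed size only grows;
--   * the bipartition A survives, since H' has fewer edges;
--   * a set S spans at most Σ_v (lost edges at v) ≤ N·εN fewer edges in H'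
--     than in H, absorbed by replacing ν with ν - ε, while the hypothesis
--     |S| ≥ (1/2 - (ν - ε))N is stronger than |S| ≥ (1/2 - ν)N.

open import Defs
open import Data.Nat using (ℕ)
open import Data.Rational using (ℚ; _+_; _-_; _*_; _≤_; _<_; 0ℚ)
open import Data.Product using (_×_)

open import Data.Nat as ℕ using (zero; suc)
import Data.Nat.Properties as ℕP
open import Data.Integer as ℤ using (+_)
import Data.Integer.Properties as ℤP
open import Data.Rational using (mkℚ; 1ℚ; -_; _/_; *≤*; ½; nonNegative)
import Data.Rational.Properties as ℚP
open import Data.Nat.Coprimality as Coprime using (1-coprimeTo)
open import Relation.Binary.PropositionalEquality as ≡ using (_≡_; refl; cong; cong₂; subst; subst₂)
open import Data.Bool using (Bool; true; false; _∧_; not; if_then_else_)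
open import Data.Fin using (Fin) renaming (zero to fzero; suc to fsuc)
open import Data.Fin.Subset using (Subset)
open import Data.Product using (_,_)
open import Data.Sum using (_⊎_; inj₁; inj₂)
open import Relation.Nullary.Decidable.Core using (dec⇒maybe)
open import Algebra.Properties.CommutativeSemigroup ℕP.+-commutativeSemigroup using (interchange)
open import Tactic.RingSolver using (solve-∀)
open import Tactic.RingSolver.Core.AlmostCommutativeRing using (AlmostCommutativeRing; fromCommutativeRing)

open ℚP.≤-Reasoning

ℚ-ring : AlmostCommutativeRing _ _
ℚ-ring = fromCommutativeRing ℚP.+-*-commutativeRing (λ x → dec⇒maybe (0ℚ ℚP.≟ x))

ι-canonical : ∀ m → ι m ≡ mkℚ (+ m) 0 (Coprime.sym (1-coprimeTo m))
ι-canonical m = ℚP.normalize-coprime (Coprime.sym (1-coprimeTo m))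

ι-+ : ∀ a b → ι (a ℕ.+ b) ≡ ι a + ι b
ι-+ a b rewrite ι-canonical a | ι-canonical b =
  ℚP./-cong {+ (a ℕ.+ b)} (≡.sym (cong₂ ℤ._+_ (ℤP.*-identityʳ (+ a)) (ℤP.*-identityʳ (+ b)))) refl

ι-mono : ∀ {a b} → a ℕ.≤ b → ι a ≤ ι b
ι-mono {a} {b} a≤b rewrite ι-canonical a | ι-canonical b =
  *≤* (subst₂ ℤ._≤_ (≡.sym (ℤP.*-identityʳ (+ a))) (≡.sym (ℤP.*-identityʳ (+ b))) (ℤ.+≤+ a≤b))

ι-nonNeg : ∀ a → 0ℚ ≤ ι a
ι-nonNeg a = ι-mono {0} {a} ℕ.z≤n

proportion-nonNeg : ∀ e n → 0ℚ ≤ e → 0ℚ ≤ e * ι n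
proportion-nonNeg e n 0≤e = begin
  0ℚ      ≡⟨ ≡.sym (ℚP.*-zeroˡ (ι n)) ⟩
  0ℚ * ι n ≤⟨ ℚP.*-monoʳ-≤-nonNeg (ι n) {{nonNegative (ι-nonNeg n)}} 0≤e ⟩
  e * ι n  ∎

≤-+-nonNeg : ∀ x y → 0ℚ ≤ y → x ≤ x + y
≤-+-nonNeg x y 0≤y = begin
  x      ≡⟨ ≡.sym (ℚP.+-identityʳ x) ⟩
  x + 0ℚ ≤⟨ ℚP.+-monoʳ-≤ x 0≤y ⟩
  x + y  ∎

lowerBound-shift : ∀ c μ ε N D D' →
  (c - μ) * N ≤ D → D - ε * N ≤ D' → (c - (μ + ε)) * N ≤ D'
lowerBound-shift c μ ε N D D' bound drop = begin
  (c - (μ + ε)) * N   ≡⟨ expand c μ ε N ⟩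
  (c - μ) * N - ε * N ≤⟨ ℚP.+-monoˡ-≤ (- (ε * N)) bound ⟩
  D - ε * N           ≤⟨ drop ⟩
  D'                  ∎
  where
  expand : ∀ c μ ε N → (c - (μ + ε)) * N ≡ (c - μ) * N - ε * N
  expand = solve-∀ ℚ-ring

upperBound-relax : ∀ c μ ε N x → 0ℚ ≤ ε * N → x ≤ (c + μ) * N → x ≤ (c + (μ + ε)) * N
upperBound-relax c μ ε N x 0≤εN bound = begin
  x                   ≤⟨ bound ⟩
  (c + μ) * N         ≤⟨ ≤-+-nonNeg _ _ 0≤εN ⟩
  (c + μ) * N + ε * N ≡⟨ collect c μ ε N ⟩
  (c + (μ + ε)) * N   ∎
  where
  collect : ∀ c μ ε N → (c + μ) * N + ε * N ≡ (c + (μ + ε)) * N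
  collect = solve-∀ ℚ-ring

lowerBound-weaken : ∀ c ν ε N x → 0ℚ ≤ ε * N → (c - (ν - ε)) * N ≤ x → (c - ν) * N ≤ x
lowerBound-weaken c ν ε N x 0≤εN bound = begin
  (c - ν) * N         ≤⟨ ≤-+-nonNeg _ _ 0≤εN ⟩
  (c - ν) * N + ε * N ≡⟨ collect c ν ε N ⟩
  (c - (ν - ε)) * N   ≤⟨ bound ⟩
  x                   ∎
  where
  collect : ∀ c ν ε N → (c - ν) * N + ε * N ≡ (c - (ν - ε)) * N
  collect = solve-∀ ℚ-ring

density-shift : ∀ ν ε N E E' → ν * N * N ≤ E → E ≤ E' + N * (ε * N) → (ν - ε) * N * N ≤ E'
density-shift ν ε N E E' dense loss = begin
  (ν - ε) * N * N         ≡⟨ expand ν ε N ⟩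
  ν * N * N - L           ≤⟨ ℚP.+-monoˡ-≤ (- L) dense ⟩
  E - L                   ≤⟨ ℚP.+-monoˡ-≤ (- L) loss ⟩
  (E' + L) - L            ≡⟨ cancel E' L ⟩
  E'                      ∎
  where
  L : ℚ
  L = N * (ε * N)
  expand : ∀ ν ε N → (ν - ε) * N * N ≡ ν * N * N - N * (ε * N)
  expand = solve-∀ ℚ-ring
  cancel : ∀ E M → (E + M) - M ≡ E
  cancel = solve-∀ ℚ-ring

summand-bound : ∀ a h M → (a + h) - M ≤ a → h ≤ M
summand-bound a h M hyp = begin
  h                     ≡⟨ rearrange a h M ⟩
  ((a + h) - M) - a + M ≤⟨ ℚP.+-monoˡ-≤ M (ℚP.+-monoˡ-≤ (- a) hyp) ⟩
  a - a + M             ≡⟨ cancel a M ⟩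
  M                     ∎
  where
  rearrange : ∀ a h M → h ≡ ((a + h) - M) - a + M
  rearrange = solve-∀ ℚ-ring
  cancel : ∀ a M → a - a + M ≡ M
  cancel = solve-∀ ℚ-ring

bit : Bool → ℕ
bit b = if b then 1 else 0

bit-union : ∀ a b c → (a ≡ true → b ≡ true ⊎ c ≡ true) → bit a ℕ.≤ bit b ℕ.+ bit c
bit-union false b c cover = ℕ.z≤n
bit-union true  b c cover with cover refl
... | inj₁ refl = ℕ.s≤s ℕ.z≤n
... | inj₂ refl = ℕP.m≤n+m 1 (bit b)

count-union : ∀ {n} (f g h : Fin n → Bool) → (∀ j → f j ≡ true → g j ≡ true ⊎ h j ≡ true) →
  count f ℕ.≤ count g ℕ.+ count h
count-union {zero}  f g h cover = ℕ.z≤n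
count-union {suc n} f g h cover = ℕP.≤-trans
  (ℕP.+-mono-≤ (bit-union (f fzero) (g fzero) (h fzero) (cover fzero))
               (count-union (λ i → f (fsuc i)) (λ i → g (fsuc i)) (λ i → h (fsuc i)) (λ j → cover (fsuc j))))
  (ℕP.≤-reflexive (interchange (bit (g fzero)) (bit (h fzero)) _ _))

bit-difference : ∀ a b → (b ≡ true → a ≡ true) → bit a ≡ bit b ℕ.+ bit (a ∧ not b)
bit-difference false false g⊆f = refl
bit-difference false true  g⊆f with g⊆f refl
... | ()
bit-difference true  false g⊆f = refl
bit-difference true  true  g⊆f = refl

count-difference : ∀ {n} (f g : Fin n → Bool) → (∀ j → g j ≡ true → f j ≡ true) →
  count f ≡ count g ℕ.+ count (λ j → f j ∧ not (g j))
count-difference {zero}  f g g⊆f = refl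
count-difference {suc n} f g g⊆f = ≡.trans
  (cong₂ ℕ._+_ (bit-difference (f fzero) (g fzero) (g⊆f fzero))
               (count-difference (λ i → f (fsuc i)) (λ i → g (fsuc i)) (λ j → g⊆f (fsuc j))))
  (interchange (bit (g fzero)) _ _ _)

sumFin-≤-+ : ∀ {n} (f g h : Fin n → ℕ) → (∀ i → f i ℕ.≤ g i ℕ.+ h i) →
  sumFin f ℕ.≤ sumFin g ℕ.+ sumFin h
sumFin-≤-+ {zero}  f g h bound = ℕ.z≤n
sumFin-≤-+ {suc n} f g h bound = ℕP.≤-trans
  (ℕP.+-mono-≤ (bound fzero)
               (sumFin-≤-+ (λ i → f (fsuc i)) (λ i → g (fsuc i)) (λ i → h (fsuc i)) (λ j → bound (fsuc j))))
  (ℕP.≤-reflexive (interchange (g fzero) (h fzero) _ _))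

sumFin-bound : ∀ {n} (f : Fin n → ℕ) c → (∀ i → ι (f i) ≤ c) → ι (sumFin f) ≤ ι n * c
sumFin-bound {zero}  f c bound = ℚP.≤-reflexive (≡.sym (ℚP.*-zeroˡ c))
sumFin-bound {suc n} f c bound = begin
  ι (f fzero ℕ.+ sumFin tail)   ≡⟨ ι-+ (f fzero) _ ⟩
  ι (f fzero) + ι (sumFin tail) ≤⟨ ℚP.+-mono-≤ (bound fzero) (sumFin-bound tail c (λ i → bound (fsuc i))) ⟩
  c + ι n * c                   ≡⟨ collect (ι n) c ⟩
  (1ℚ + ι n) * c                ≡⟨ cong (_* c) (≡.sym (ι-+ 1 n)) ⟩
  ι (suc n) * c                 ∎
  where
  tail : Fin n → ℕ
  tail i = f (fsuc i)
  collect : ∀ N c → c + N * c ≡ (1ℚ + N) * c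
  collect = solve-∀ ℚ-ring

-- Pointwise form of the edge-loss estimate: a pair counted in eSpan H S
-- is counted in eSpan H' S, or is an H-edge missing from H'.
spanned-kept-or-lost : ∀ inI inJ e order e' →
  (inI ∧ inJ ∧ e ∧ order) ≡ true → (inI ∧ inJ ∧ e' ∧ order) ≡ true ⊎ (e ∧ not e') ≡ true
spanned-kept-or-lost false _     _     _     _     ()
spanned-kept-or-lost true  false _     _     _     ()
spanned-kept-or-lost true  true  false _     _     ()
spanned-kept-or-lost true  true  true  false _     ()
spanned-kept-or-lost true  true  true  true  true  refl = inj₁ refl
spanned-kept-or-lost true  true  true  true  false refl = inj₂ refl

bipartite-subgraph : ∀ {n} (H H' : Graph n) (A : Subset n) →
  SpanningSubgraph H' H → BalancedBipartite H A → BalancedBipartite H' A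
bipartite-subgraph H H' A sub (balanced , crossing) = balanced , λ i j e → crossing i j (sub i j e)

module EdgeDeletion (ε : ℚ) (n : ℕ) (H H' : Graph n) (0≤ε : 0ℚ ≤ ε)
  (sub : SpanningSubgraph H' H) (degree-drop : ∀ v → ι (deg H v) - ε * ι n ≤ ι (deg H' v)) where

  εn-nonNeg : 0ℚ ≤ ε * ι n
  εn-nonNeg = proportion-nonNeg ε n 0≤ε

  lost : Fin n → Fin n → Bool
  lost i j = adj H i j ∧ not (adj H' i j)

  deg-split : ∀ i → deg H i ≡ deg H' i ℕ.+ count (lost i)
  deg-split i = count-difference (adj H i) (adj H' i) (sub i)

  lost-bound : ∀ i → ι (count (lost i)) ≤ ε * ι n
  lost-bound i = summand-bound (ι (deg H' i)) (ι (count (lost i))) (ε * ι n)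
    (subst (λ d → d - ε * ι n ≤ ι (deg H' i)) split (degree-drop i))
    where
    split : ι (deg H i) ≡ ι (deg H' i) + ι (count (lost i))
    split = ≡.trans (cong ι (deg-split i)) (ι-+ (deg H' i) _)

  eSpan-loss : ∀ S → eSpan H S ℕ.≤ eSpan H' S ℕ.+ sumFin (λ i → count (lost i))
  eSpan-loss S = sumFin-≤-+ _ _ _ λ i → count-union _ _ _ λ j →
    spanned-kept-or-lost (inS S i) (inS S j) (adj H i j) _ (adj H' i j)

  eSpan-bound : ∀ S → ι (eSpan H S) ≤ ι (eSpan H' S) + ι n * (ε * ι n)
  eSpan-bound S = begin
    ι (eSpan H S)                                      ≤⟨ ι-mono (eSpan-loss S) ⟩
    ι (eSpan H' S ℕ.+ sumFin (λ i → count (lost i)))   ≡⟨ ι-+ (eSpan H' S) _ ⟩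
    ι (eSpan H' S) + ι (sumFin (λ i → count (lost i))) ≤⟨ ℚP.+-monoʳ-≤ (ι (eSpan H' S)) (sumFin-bound _ (ε * ι n) lost-bound) ⟩
    ι (eSpan H' S) + ι n * (ε * ι n)                   ∎

  minDeg-shift : ∀ c μ → MinDeg≥ H (c - μ) → MinDeg≥ H' (c - (μ + ε))
  minDeg-shift c μ δH v = lowerBound-shift c μ ε (ι n) _ _ (δH v) (degree-drop v)

  type1-shift : ∀ μ ν → Type1 μ ν H → Type1 (μ + ε) (ν - ε) H'
  type1-shift μ ν (δH , dense) = minDeg-shift ½ μ δH , λ S large →
    density-shift ν ε (ι n) _ _
      (dense S (lowerBound-weaken ½ ν ε (ι n) _ εn-nonNeg large))
      (eSpan-bound S)

  type2-shift : ∀ μ ν → Type2 μ ν H → Type2 (μ + ε) (ν - ε) H'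
  type2-shift μ ν ((A , bipartite) , δH , (X , small , highDeg)) =
    (A , bipartite-subgraph H H' A sub bipartite) ,
    minDeg-shift (+ 1 / 32) μ δH ,
    (X , upperBound-relax (+ 1 / 64) μ ε (ι n) _ εn-nonNeg small ,
     λ v v∉X → lowerBound-shift (+ 1 / 3) μ ε (ι n) _ _ (highDeg v v∉X) (degree-drop v))

lemma3p9 : (μ ν ε : ℚ) (n : ℕ) (H H' : Graph n) →
    RobustlyTwoMatchable μ ν H →
    0ℚ < ε →
    SpanningSubgraph H' H →
    (∀ v → ι (deg H v) - ε * ι n ≤ ι (deg H' v)) →
    RobustlyTwoMatchable (μ + ε) (ν - ε) H' ×
    (Type1 μ ν H → Type1 (μ + ε) (ν - ε) H') ×
    (Type2 μ ν H → Type2 (μ + ε) (ν - ε) H')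
lemma3p9 μ ν ε n H H' robust 0<ε sub degree-drop =
  sameType robust , type1-shift μ ν , type2-shift μ ν
  where
  open EdgeDeletion ε n H H' (ℚP.<⇒≤ 0<ε) sub degree-drop
  sameType : RobustlyTwoMatchable μ ν H → RobustlyTwoMatchable (μ + ε) (ν - ε) H'
  sameType (inj₁ type1) = inj₁ (type1-shift μ ν type1)
  sameType (inj₂ type2) = inj₂ (type2-shift μ ν type2)
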